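{- Let $k\geq 2$ and let $\psi_1,\psi_2,\psi_3\in\Psi$ be three distinct linear forms. If $\Pi(\psi_1,\psi_2,\psi_3)$ has codimension $1$ in $\mathbb{R}^{2k}$, then $\psi_1,\psi_2,\psi_3$ share a common set of variables.
   Context: For $v\in\{1,\dots,k\}$ and $I\subset\{1,\dots,k\}$ let $\psi_{v,I}(\mathbf{x},\mathbf{y})=\sum_{i\in I}(v-i)x_i+\sum_{i\notin I}(v-i)y_i$ for $(\mathbf{x},\mathbf{y})\in\mathbb{R}^k\times\mathbb{R}^k$; $\Psi$ is the set of all such forms. Since $\psi_{v,I\cup\{v\}}=\psi_{v,I\setminus\{v\}}$, each $\psi\in\Psi$ can be written uniquely as $\psi=\psi_{v(\psi),I(\psi)}$ with $v(\psi)\in I(\psi)$. A collection $\psi_1,\dots,\psi_s\in\Psi$ shares a common set of variables if there is $I\subset\{1,\dots,k\}$ with $I(\psi_j)=I\cup\{v(\psi_j)\}$ for every $j$. For $\psi_1,\dots,\psi_s\in\Psi$, $\Pi(\psi_1,\dots,\psi_s)$ is the linear subspace of $(\mathbf{x},\mathbf{y})$ on which $\psi_1(\mathbf{x},\mathbf{y}),\dots,\psi_s(\mathbf{x},\mathbf{y})$ are all equal.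
   Formalization: The ambient space is ℚ^k × ℚ^k rather than $\mathbb{R}^{2k}$, so distinctness of the forms, $\Pi(\psi_1,\psi_2,\psi_3)$ and its codimension refer to rational points and rational linear functionals. -}

module Defs where

open import Data.Nat using (ℕ; zero; suc)
open import Data.Fin using (Fin; toℕ)
import Data.Fin as F
open import Data.Bool using (Bool; if_then_else_)
open import Data.Vec using (lookup)
open import Data.Fin.Subset using (Subset; _∪_; ⁅_⁆)
import Data.Integer as ℤ
open import Data.Rational using (ℚ; _+_; _*_; _/_; 0ℚ)
open import Data.Product using (Σ; ∃; _×_; _,_)
open import Relation.Binary.PropositionalEquality using (_≡_; _≢_)
open import Relation.Nullary using (¬_)
open import Function.Bundles using (_⇔_)

sumFin : {k : ℕ} → (Fin k → ℚ) → ℚ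
sumFin {zero}  f = 0ℚ
sumFin {suc k} f = f F.zero + sumFin (λ i → f (F.suc i))

-- Points of ℚ^k × ℚ^k (playing the role of ℝ^k × ℝ^k).
Point : ℕ → Set
Point k = (Fin k → ℚ) × (Fin k → ℚ)

-- A (not necessarily canonical) presentation (v , I) of ψ_{v,I}.
-- Indices are 0-based: Fin k = {0,…,k-1} stands for {1,…,k}; the
-- coefficients v - i are invariant under this shift.
record Form (k : ℕ) : Set where
  constructor form
  field
    v : Fin k
    I : Subset k
open Form public

coef : {k : ℕ} → Fin k → Fin k → ℚ
coef v i = (toℕ v ℤ.⊖ toℕ i) / 1

eval : {k : ℕ} → Form k → Point k → ℚ
eval (form v I) (x , y) =
  sumFin (λ i → coef v i * (if lookup I i then x i else y i))

DistinctForms : {k : ℕ} → Form k → Form k → Set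
DistinctForms ψ φ = ¬ (∀ p → eval ψ p ≡ eval φ p)

-- the canonical set I(ψ) (the unique I with v(ψ) ∈ I(ψ))
Iset : {k : ℕ} → Form k → Subset k
Iset (form v I) = I ∪ ⁅ v ⁆

ShareCommonVars3 : {k : ℕ} → Form k → Form k → Form k → Set
ShareCommonVars3 {k} ψ₁ ψ₂ ψ₃ =
  Σ (Subset k) λ J →
    (Iset ψ₁ ≡ J ∪ ⁅ v ψ₁ ⁆) × (Iset ψ₂ ≡ J ∪ ⁅ v ψ₂ ⁆) × (Iset ψ₃ ≡ J ∪ ⁅ v ψ₃ ⁆)

InΠ3 : {k : ℕ} → Form k → Form k → Form k → Point k → Set
InΠ3 ψ₁ ψ₂ ψ₃ p = (eval ψ₁ p ≡ eval ψ₂ p) × (eval ψ₂ p ≡ eval ψ₃ p)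

linFun : {k : ℕ} → Point k → Point k → ℚ
linFun (c , d) (x , y) = sumFin (λ i → c i * x i) + sumFin (λ i → d i * y i)

NonZeroFunctional : {k : ℕ} → Point k → Set
NonZeroFunctional (c , d) = ¬ ((∀ i → c i ≡ 0ℚ) × (∀ i → d i ≡ 0ℚ))

-- A subspace S has codimension 1 iff it is the kernel of a nonzero
-- linear functional (a hyperplane).
Codim1 : {k : ℕ} → (Point k → Set) → Set
Codim1 {k} S = Σ (Point k) λ cd → NonZeroFunctional cd × (∀ p → S p ⇔ (linFun cd p ≡ 0ℚ))

-- Since Π(ψ₁,ψ₂,ψ₃) is the kernel of a functional L, pick p₀ with L p₀ ≠ 0; for every q the
-- point L(q)·p₀ − L(p₀)·q lies in Π, which forces the "determinant" relation
-- a₁ψ₁ + a₂ψ₂ + a₃ψ₃ = 0 with aⱼ the cyclic differences ψⱼ₊₁(p₀) − ψⱼ₊₂(p₀). These sum to 0 and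
-- are not all 0, so distinctness of the forms makes each of them nonzero. Now compare the
-- coefficients of xᵢ and of yᵢ: a form ψ with v(ψ) ≠ i has exactly one of them nonzero, chosen
-- by whether i ∈ I(ψ), while every form has at least one of them zero. If two forms with centres
-- ≠ i disagreed about i, one of the two coordinate equations would have a single nonzero term.
-- So the forms agree away from their centres, and J = I(ψ₁) ∩ I(ψ₂) ∩ I(ψ₃) is a common set.
module Submission where

open import Defs
open import Level using (0ℓ)
open import Data.Nat using (ℕ; zero; suc; _≤_)
open import Data.Fin as Fin using (Fin; toℕ)
import Data.Fin.Properties as Fin
open import Data.Fin.Subset using (Subset; _∪_; _∩_; ⁅_⁆; _∈_; _⊆_)
open import Data.Fin.Subset.Properties
  using (⊆-antisym; x∈p∪q⁻; x∈p∪q⁺; q⊆p∪q; x∈p∩q⁺; p∩q⊆p; p∩q⊆q; x∈⁅x⁆)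
open import Data.Bool using (true; false; if_then_else_)
open import Data.Vec using (lookup)
open import Data.Vec.Properties using ([]=⇒lookup; lookup⇒[]=)
import Data.Integer as ℤ
import Data.Integer.Properties as ℤ
open import Data.Integer.GCD using (gcd)
open import Data.Rational using (ℚ; _+_; _*_; _-_; -_; _/_; 0ℚ; 1ℚ; ↥_; 1/_; NonZero; ≢-nonZero)
import Data.Rational.Properties as ℚ
open import Algebra.Properties.Group ℚ.+-0-group using (x∙y⁻¹≈ε⇒x≈y; x≈y⇒x∙y⁻¹≈ε; inverseʳ-unique)
open import Data.Product using (∃; _×_; _,_; proj₁; proj₂)
open import Data.Sum using (inj₁; inj₂)
open import Data.Empty using (⊥-elim)
open import Function using (_∘_)
open import Function.Bundles using (Equivalence)
open import Relation.Binary.PropositionalEquality using (_≡_; _≢_; refl; sym; trans; cong; cong₂; module ≡-Reasoning)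
open import Relation.Nullary using (¬_; yes; no)
open import Relation.Nullary.Decidable.Core using (dec⇒maybe)
open import Tactic.RingSolver.Core.AlmostCommutativeRing using (AlmostCommutativeRing; fromCommutativeRing)
open import Tactic.RingSolver using (solve-∀)

private
  variable
    k : ℕ
    ψ φ χ ψ₁ ψ₂ ψ₃ : Form k

ℚ-ring : AlmostCommutativeRing 0ℓ 0ℓ
ℚ-ring = fromCommutativeRing ℚ.+-*-commutativeRing (λ x → dec⇒maybe (0ℚ ℚ.≟ x))

p-q≡0⇒p≡q : ∀ {p q} → p - q ≡ 0ℚ → p ≡ q
p-q≡0⇒p≡q = x∙y⁻¹≈ε⇒x≈y _ _

p≢0∧p*q≡0⇒q≡0 : ∀ {p q} → p ≢ 0ℚ → p * q ≡ 0ℚ → q ≡ 0ℚ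
p≢0∧p*q≡0⇒q≡0 {p} {q} p≢0 pq≡0 = begin
  q                ≡⟨ sym (ℚ.*-identityˡ q) ⟩
  1ℚ * q           ≡⟨ cong (_* q) (sym (ℚ.*-inverseˡ p)) ⟩
  (1/ p) * p * q   ≡⟨ ℚ.*-assoc (1/ p) p q ⟩
  (1/ p) * (p * q) ≡⟨ cong ((1/ p) *_) pq≡0 ⟩
  (1/ p) * 0ℚ      ≡⟨ ℚ.*-zeroʳ (1/ p) ⟩
  0ℚ               ∎
  where
  open ≡-Reasoning
  instance _ : NonZero p
           _ = ≢-nonZero p≢0

*-≢0 : ∀ {p q} → p ≢ 0ℚ → q ≢ 0ℚ → p * q ≢ 0ℚ
*-≢0 p≢0 q≢0 = q≢0 ∘ p≢0∧p*q≡0⇒q≡0 p≢0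

lone-first-term : ∀ {a x} b c → a ≢ 0ℚ → x ≢ 0ℚ → a * x + b * 0ℚ + c * 0ℚ ≢ 0ℚ
lone-first-term {a} {x} b c a≢0 x≢0 = *-≢0 a≢0 x≢0 ∘ trans (sym (drop-zeros a x b c))
  where
  drop-zeros : ∀ a x b c → a * x + b * 0ℚ + c * 0ℚ ≡ a * x
  drop-zeros = solve-∀ ℚ-ring

lone-second-term : ∀ a {b y} c → b ≢ 0ℚ → y ≢ 0ℚ → a * 0ℚ + b * y + c * 0ℚ ≢ 0ℚ
lone-second-term a {b} {y} c b≢0 y≢0 = lone-first-term a c b≢0 y≢0 ∘ trans (swap a b y c)
  where
  swap : ∀ a b y c → b * y + a * 0ℚ + c * 0ℚ ≡ a * 0ℚ + b * y + c * 0ℚ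
  swap = solve-∀ ℚ-ring

coef-≢0 : {v i : Fin k} → v ≢ i → coef v i ≢ 0ℚ
coef-≢0 {v = v} {i} v≢i coef≡0 = v≢i (Fin.toℕ-injective (ℤ.+-injective (ℤ.i-j≡0⇒i≡j _ _ v-i≡0)))
  where
  z : ℤ.ℤ
  z = toℕ v ℤ.⊖ toℕ i
  z≡0 : z ≡ ℤ.0ℤ
  z≡0 = begin
    z                                     ≡⟨ sym (ℚ.↥-/ z 1) ⟩
    ↥ (z / 1) ℤ.* gcd z (ℤ.+ 1)          ≡⟨ cong (λ r → ↥ r ℤ.* gcd z (ℤ.+ 1)) coef≡0 ⟩
    ℤ.0ℤ ℤ.* gcd z (ℤ.+ 1)               ≡⟨ ℤ.*-zeroˡ (gcd z (ℤ.+ 1)) ⟩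
    ℤ.0ℤ                                  ∎
    where open ≡-Reasoning
  v-i≡0 : ℤ.+ toℕ v ℤ.- ℤ.+ toℕ i ≡ ℤ.0ℤ
  v-i≡0 = trans (ℤ.m-n≡m⊖n (toℕ v) (toℕ i)) z≡0

sumFin-cong : {f g : Fin k → ℚ} → (∀ i → f i ≡ g i) → sumFin f ≡ sumFin g
sumFin-cong {zero}  f≗g = refl
sumFin-cong {suc k} f≗g = cong₂ _+_ (f≗g Fin.zero) (sumFin-cong (f≗g ∘ Fin.suc))

sumFin-zero : {f : Fin k → ℚ} → (∀ i → f i ≡ 0ℚ) → sumFin f ≡ 0ℚ
sumFin-zero {zero}  f≗0 = refl
sumFin-zero {suc k} f≗0 =
  trans (cong₂ _+_ (f≗0 Fin.zero) (sumFin-zero (f≗0 ∘ Fin.suc))) (ℚ.+-identityˡ 0ℚ)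

sumFin-+ : (f g : Fin k → ℚ) → sumFin (λ i → f i + g i) ≡ sumFin f + sumFin g
sumFin-+ {zero}  f g = refl
sumFin-+ {suc k} f g = trans (cong (f Fin.zero + g Fin.zero +_) (sumFin-+ (f ∘ Fin.suc) (g ∘ Fin.suc)))
                             (interchange (f Fin.zero) (g Fin.zero) _ _)
  where
  interchange : ∀ a b c d → a + b + (c + d) ≡ a + c + (b + d)
  interchange = solve-∀ ℚ-ring

sumFin-*ˡ : (a : ℚ) (f : Fin k → ℚ) → sumFin (λ i → a * f i) ≡ a * sumFin f
sumFin-*ˡ {zero}  a f = sym (ℚ.*-zeroʳ a)
sumFin-*ˡ {suc k} a f = trans (cong (a * f Fin.zero +_) (sumFin-*ˡ a (f ∘ Fin.suc)))
                              (sym (ℚ.*-distribˡ-+ a (f Fin.zero) _))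

δ : Fin k → Fin k → ℚ
δ Fin.zero    Fin.zero    = 1ℚ
δ Fin.zero    (Fin.suc j) = 0ℚ
δ (Fin.suc i) Fin.zero    = 0ℚ
δ (Fin.suc i) (Fin.suc j) = δ i j

sumFin-δ : (f : Fin k → ℚ) (i : Fin k) → sumFin (λ j → f j * δ i j) ≡ f i
sumFin-δ {suc k} f Fin.zero = trans
  (cong₂ _+_ (ℚ.*-identityʳ (f Fin.zero)) (sumFin-zero (ℚ.*-zeroʳ ∘ f ∘ Fin.suc)))
  (ℚ.+-identityʳ (f Fin.zero))
sumFin-δ {suc k} f (Fin.suc i) = trans
  (cong₂ _+_ (ℚ.*-zeroʳ (f Fin.zero)) (sumFin-δ (f ∘ Fin.suc) i))
  (ℚ.+-identityˡ (f (Fin.suc i)))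

eˣ eʸ : Fin k → Point k
eˣ i = δ i , λ _ → 0ℚ
eʸ i = (λ _ → 0ℚ) , δ i

linFun-eˣ : (c d : Fin k → ℚ) (i : Fin k) → linFun (c , d) (eˣ i) ≡ c i
linFun-eˣ c d i =
  trans (cong₂ _+_ (sumFin-δ c i) (sumFin-zero (ℚ.*-zeroʳ ∘ d))) (ℚ.+-identityʳ (c i))

linFun-eʸ : (c d : Fin k → ℚ) (i : Fin k) → linFun (c , d) (eʸ i) ≡ d i
linFun-eʸ c d i =
  trans (cong₂ _+_ (sumFin-zero (ℚ.*-zeroʳ ∘ c)) (sumFin-δ d i)) (ℚ.+-identityˡ (d i))

lincomb : ℚ → Point k → ℚ → Point k → Point k
lincomb a (x , y) b (x′ , y′) = (λ i → a * x i + b * x′ i) , (λ i → a * y i + b * y′ i)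

linFun-lincomb : (L : Point k) (a : ℚ) (p : Point k) (b : ℚ) (q : Point k) →
                 linFun L (lincomb a p b q) ≡ a * linFun L p + b * linFun L q
linFun-lincomb {k} (c , d) a (x , y) b (x′ , y′) =
  trans (cong₂ _+_ (dot-lincomb c x x′) (dot-lincomb d y y′))
        (regroup a b (sumFin (λ i → c i * x i)) _ _ _)
  where
  regroup : ∀ a b X X′ Y Y′ → a * X + b * X′ + (a * Y + b * Y′) ≡ a * (X + Y) + b * (X′ + Y′)
  regroup = solve-∀ ℚ-ring
  distrib : ∀ c a x b x′ → c * (a * x + b * x′) ≡ a * (c * x) + b * (c * x′)
  distrib = solve-∀ ℚ-ring
  dot-lincomb : (c x x′ : Fin k → ℚ) →
                sumFin (λ i → c i * (a * x i + b * x′ i))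
                ≡ a * sumFin (λ i → c i * x i) + b * sumFin (λ i → c i * x′ i)
  dot-lincomb c x x′ = begin
    sumFin (λ i → c i * (a * x i + b * x′ i))             ≡⟨ sumFin-cong (λ i → distrib (c i) a (x i) b (x′ i)) ⟩
    sumFin (λ i → a * (c i * x i) + b * (c i * x′ i))
      ≡⟨ sumFin-+ (λ i → a * (c i * x i)) (λ i → b * (c i * x′ i)) ⟩
    sumFin (λ i → a * (c i * x i)) + sumFin (λ i → b * (c i * x′ i))
      ≡⟨ cong₂ _+_ (sumFin-*ˡ a (λ i → c i * x i)) (sumFin-*ˡ b (λ i → c i * x′ i)) ⟩
    a * sumFin (λ i → c i * x i) + b * sumFin (λ i → c i * x′ i) ∎
    where open ≡-Reasoning

xcoef ycoef : Form k → Fin k → ℚ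
xcoef (form v I) i = if lookup I i then coef v i else 0ℚ
ycoef (form v I) i = if lookup I i then 0ℚ else coef v i

eval≡linFun : (ψ : Form k) (p : Point k) → eval ψ p ≡ linFun (xcoef ψ , ycoef ψ) p
eval≡linFun (form v I) (x , y) =
  trans (sumFin-cong split) (sumFin-+ (λ i → xcoef (form v I) i * x i) (λ i → ycoef (form v I) i * y i))
  where
  split : ∀ i → coef v i * (if lookup I i then x i else y i)
              ≡ xcoef (form v I) i * x i + ycoef (form v I) i * y i
  split i with lookup I i
  ... | true  = sym (trans (cong (coef v i * x i +_) (ℚ.*-zeroˡ (y i))) (ℚ.+-identityʳ _))
  ... | false = sym (trans (cong (_+ coef v i * y i) (ℚ.*-zeroˡ (x i))) (ℚ.+-identityˡ _))

eval-lincomb : (ψ : Form k) (a : ℚ) (p : Point k) (b : ℚ) (q : Point k) →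
               eval ψ (lincomb a p b q) ≡ a * eval ψ p + b * eval ψ q
eval-lincomb ψ a p b q = begin
  eval ψ (lincomb a p b q)                        ≡⟨ eval≡linFun ψ _ ⟩
  linFun L (lincomb a p b q)                      ≡⟨ linFun-lincomb L a p b q ⟩
  a * linFun L p + b * linFun L q                 ≡⟨ sym (cong₂ (λ u w → a * u + b * w) (eval≡linFun ψ p) (eval≡linFun ψ q)) ⟩
  a * eval ψ p + b * eval ψ q                     ∎
  where
  open ≡-Reasoning
  L : Point _
  L = xcoef ψ , ycoef ψ

eval-eˣ : (ψ : Form k) (i : Fin k) → eval ψ (eˣ i) ≡ xcoef ψ i
eval-eˣ ψ i = trans (eval≡linFun ψ (eˣ i)) (linFun-eˣ (xcoef ψ) (ycoef ψ) i)

eval-eʸ : (ψ : Form k) (i : Fin k) → eval ψ (eʸ i) ≡ ycoef ψ i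
eval-eʸ ψ i = trans (eval≡linFun ψ (eʸ i)) (linFun-eʸ (xcoef ψ) (ycoef ψ) i)

record LinearRelation (ψ₁ ψ₂ ψ₃ : Form k) : Set where
  field
    a₁ a₂ a₃   : ℚ
    nontrivial : ¬ (a₁ ≡ 0ℚ × a₂ ≡ 0ℚ × a₃ ≡ 0ℚ)
    balanced   : a₁ + a₂ + a₃ ≡ 0ℚ
    vanishes   : ∀ p → a₁ * eval ψ₁ p + a₂ * eval ψ₂ p + a₃ * eval ψ₃ p ≡ 0ℚ

open LinearRelation

rotate : LinearRelation ψ₁ ψ₂ ψ₃ → LinearRelation ψ₂ ψ₃ ψ₁
rotate R = record
  { a₁ = a₂ R ; a₂ = a₃ R ; a₃ = a₁ R
  ; nontrivial = λ (a₂≡0 , a₃≡0 , a₁≡0) → nontrivial R (a₁≡0 , a₂≡0 , a₃≡0)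
  ; balanced   = trans (+-rotate (a₁ R) _ _) (balanced R)
  ; vanishes   = λ p → trans (+-rotate (a₁ R * _) _ _) (vanishes R p)
  }
  where
  +-rotate : ∀ x y z → y + z + x ≡ x + y + z
  +-rotate = solve-∀ ℚ-ring

DistinctForms-sym : DistinctForms ψ φ → DistinctForms φ ψ
DistinctForms-sym ψ≢φ φ≗ψ = ψ≢φ (sym ∘ φ≗ψ)

last-coefficient-≢0 : (R : LinearRelation ψ₁ ψ₂ ψ₃) → DistinctForms ψ₁ ψ₂ → a₃ R ≢ 0ℚ
last-coefficient-≢0 {ψ₁ = ψ₁} {ψ₂} {ψ₃} R ψ₁≢ψ₂ a₃≡0 =
  ψ₁≢ψ₂ (λ p → p-q≡0⇒p≡q (p≢0∧p*q≡0⇒q≡0 a₁≢0 (a₁[ψ₁-ψ₂]≡0 p)))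
  where
  a₂≡-a₁ : a₂ R ≡ - a₁ R
  a₂≡-a₁ = inverseʳ-unique _ _ (trans (sym (ℚ.+-identityʳ _))
                                      (trans (cong (a₁ R + a₂ R +_) (sym a₃≡0)) (balanced R)))
  a₁≢0 : a₁ R ≢ 0ℚ
  a₁≢0 a₁≡0 = nontrivial R (a₁≡0 , trans a₂≡-a₁ (cong -_ a₁≡0) , a₃≡0)
  a₁[ψ₁-ψ₂]≡0 : ∀ p → a₁ R * (eval ψ₁ p - eval ψ₂ p) ≡ 0ℚ
  a₁[ψ₁-ψ₂]≡0 p = begin
    a₁ R * (eval ψ₁ p - eval ψ₂ p)                              ≡⟨ expand (a₁ R) _ _ (eval ψ₃ p) ⟩
    a₁ R * eval ψ₁ p + (- a₁ R) * eval ψ₂ p + 0ℚ * eval ψ₃ p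
      ≡⟨ cong₂ (λ b c → a₁ R * eval ψ₁ p + b * eval ψ₂ p + c * eval ψ₃ p) (sym a₂≡-a₁) (sym a₃≡0) ⟩
    a₁ R * eval ψ₁ p + a₂ R * eval ψ₂ p + a₃ R * eval ψ₃ p    ≡⟨ vanishes R p ⟩
    0ℚ                                                        ∎
    where
    open ≡-Reasoning
    expand : ∀ a x y z → a * (x - y) ≡ a * x + (- a) * y + 0ℚ * z
    expand = solve-∀ ℚ-ring

∃-nonzero-value : (L : Point k) → NonZeroFunctional L → ∃ λ p → linFun L p ≢ 0ℚ
∃-nonzero-value {k} (c , d) L≢0 with Fin.all? (λ i → c i ℚ.≟ 0ℚ) | Fin.all? (λ i → d i ℚ.≟ 0ℚ)
... | yes c≗0 | yes d≗0 = ⊥-elim (L≢0 (c≗0 , d≗0))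
... | no c≉0  | _       =
  let i , cᵢ≢0 = Fin.¬∀⟶∃¬ k _ (λ i → c i ℚ.≟ 0ℚ) c≉0
  in eˣ i , cᵢ≢0 ∘ trans (sym (linFun-eˣ c d i))
... | yes _   | no d≉0  =
  let i , dᵢ≢0 = Fin.¬∀⟶∃¬ k _ (λ i → d i ℚ.≟ 0ℚ) d≉0
  in eʸ i , dᵢ≢0 ∘ trans (sym (linFun-eʸ c d i))

cyclic-relation : ∀ l m A₁ A₂ A₃ X₁ X₂ X₃ →
  l * A₁ + (- m) * X₁ ≡ l * A₂ + (- m) * X₂ → l * A₂ + (- m) * X₂ ≡ l * A₃ + (- m) * X₃ →
  m * ((A₂ - A₃) * X₁ + (A₃ - A₁) * X₂ + (A₁ - A₂) * X₃) ≡ 0ℚ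
cyclic-relation l m A₁ A₂ A₃ X₁ X₂ X₃ R₁≡R₂ R₂≡R₃ = begin
  m * ((A₂ - A₃) * X₁ + (A₃ - A₁) * X₂ + (A₁ - A₂) * X₃)
    ≡⟨ identity l m A₁ A₂ A₃ X₁ X₂ X₃ ⟩
  (A₃ - A₂) * (R₁ - R₂) + (A₁ - A₂) * (R₂ - R₃)
    ≡⟨ cong₂ (λ u w → (A₃ - A₂) * u + (A₁ - A₂) * w) (x≈y⇒x∙y⁻¹≈ε R₁≡R₂) (x≈y⇒x∙y⁻¹≈ε R₂≡R₃) ⟩
  (A₃ - A₂) * 0ℚ + (A₁ - A₂) * 0ℚ
    ≡⟨ annihilate (A₃ - A₂) (A₁ - A₂) ⟩
  0ℚ ∎
  where
  open ≡-Reasoning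
  R₁ R₂ R₃ : ℚ
  R₁ = l * A₁ + (- m) * X₁
  R₂ = l * A₂ + (- m) * X₂
  R₃ = l * A₃ + (- m) * X₃
  identity : ∀ l m A₁ A₂ A₃ X₁ X₂ X₃ →
    m * ((A₂ - A₃) * X₁ + (A₃ - A₁) * X₂ + (A₁ - A₂) * X₃)
    ≡ (A₃ - A₂) * ((l * A₁ + (- m) * X₁) - (l * A₂ + (- m) * X₂))
      + (A₁ - A₂) * ((l * A₂ + (- m) * X₂) - (l * A₃ + (- m) * X₃))
  identity = solve-∀ ℚ-ring
  annihilate : ∀ a b → a * 0ℚ + b * 0ℚ ≡ 0ℚ
  annihilate = solve-∀ ℚ-ring

codim1⇒linearRelation : Codim1 (InΠ3 ψ₁ ψ₂ ψ₃) → LinearRelation ψ₁ ψ₂ ψ₃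
codim1⇒linearRelation {ψ₁ = ψ₁} {ψ₂} {ψ₃} (L , L≢0 , Π⇔kerL) with ∃-nonzero-value L L≢0
... | p₀ , Lp₀≢0 = record
  { a₁         = A₂ - A₃
  ; a₂         = A₃ - A₁
  ; a₃         = A₁ - A₂
  ; nontrivial = λ (a₁≡0 , _ , a₃≡0) →
      Lp₀≢0 (Equivalence.to (Π⇔kerL p₀) (p-q≡0⇒p≡q a₃≡0 , p-q≡0⇒p≡q a₁≡0))
  ; balanced   = cyclic-sum A₁ A₂ A₃
  ; vanishes   = λ q → p≢0∧p*q≡0⇒q≡0 Lp₀≢0 (relation-at q)
  }
  where
  A₁ A₂ A₃ : ℚ
  A₁ = eval ψ₁ p₀
  A₂ = eval ψ₂ p₀
  A₃ = eval ψ₃ p₀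
  cyclic-sum : ∀ A₁ A₂ A₃ → (A₂ - A₃) + (A₃ - A₁) + (A₁ - A₂) ≡ 0ℚ
  cyclic-sum = solve-∀ ℚ-ring
  cancels : ∀ l m → l * m + (- m) * l ≡ 0ℚ
  cancels = solve-∀ ℚ-ring
  relation-at : ∀ q → linFun L p₀ * ((A₂ - A₃) * eval ψ₁ q + (A₃ - A₁) * eval ψ₂ q + (A₁ - A₂) * eval ψ₃ q) ≡ 0ℚ
  relation-at q = cyclic-relation l m A₁ A₂ A₃ _ _ _
    (trans (sym (eval-r ψ₁)) (trans (proj₁ r∈Π) (eval-r ψ₂)))
    (trans (sym (eval-r ψ₂)) (trans (proj₂ r∈Π) (eval-r ψ₃)))
    where
    l m : ℚ
    l = linFun L q
    m = linFun L p₀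
    r : Point _
    r = lincomb l p₀ (- m) q
    eval-r : ∀ ψ → eval ψ r ≡ l * eval ψ p₀ + (- m) * eval ψ q
    eval-r ψ = eval-lincomb ψ l p₀ (- m) q
    r∈Π : InΠ3 ψ₁ ψ₂ ψ₃ r
    r∈Π = Equivalence.from (Π⇔kerL r) (trans (linFun-lincomb L l p₀ (- m) q) (cancels l m))

record AgreeOffCentres (ψ φ : Form k) : Set where
  constructor agree
  field
    agrees : ∀ {i} → v ψ ≢ i → v φ ≢ i → lookup (I ψ) i ≡ lookup (I φ) i

open AgreeOffCentres

AgreeOffCentres-refl : AgreeOffCentres ψ ψ
AgreeOffCentres-refl = agree λ _ _ → refl

AgreeOffCentres-sym : AgreeOffCentres ψ φ → AgreeOffCentres φ ψ
AgreeOffCentres-sym ψ~φ = agree λ vφ≢i vψ≢i → sym (agrees ψ~φ vψ≢i vφ≢i)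

vanishes-at : (R : LinearRelation ψ φ χ) (p : Point k) {x y z : ℚ} →
              eval ψ p ≡ x → eval φ p ≡ y → eval χ p ≡ z → a₁ R * x + a₂ R * y + a₃ R * z ≡ 0ℚ
vanishes-at R p refl refl refl = vanishes R p

relation-on-xcoef : (R : LinearRelation ψ φ χ) (i : Fin k) →
                    a₁ R * xcoef ψ i + a₂ R * xcoef φ i + a₃ R * xcoef χ i ≡ 0ℚ
relation-on-xcoef {ψ = ψ} {φ} {χ} R i = vanishes-at R (eˣ i) (eval-eˣ ψ i) (eval-eˣ φ i) (eval-eˣ χ i)

relation-on-ycoef : (R : LinearRelation ψ φ χ) (i : Fin k) →
                    a₁ R * ycoef ψ i + a₂ R * ycoef φ i + a₃ R * ycoef χ i ≡ 0ℚ
relation-on-ycoef {ψ = ψ} {φ} {χ} R i = vanishes-at R (eʸ i) (eval-eʸ ψ i) (eval-eʸ φ i) (eval-eʸ χ i)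

linearRelation⇒agreeOffCentres : (R : LinearRelation ψ φ χ) → a₁ R ≢ 0ℚ → a₂ R ≢ 0ℚ → AgreeOffCentres ψ φ
linearRelation⇒agreeOffCentres {ψ = ψ} {φ} {χ} R a₁≢0 a₂≢0 = agree agrees-at
  where
  agrees-at : ∀ {i} → v ψ ≢ i → v φ ≢ i → lookup (I ψ) i ≡ lookup (I φ) i
  -- Abstracting the three bits also abstracts them in the types of rx and ry, where the
  -- ifs of xcoef and ycoef then compute.
  agrees-at {i} vψ≢i vφ≢i
    with lookup (I ψ) i | lookup (I φ) i | lookup (I χ) i | relation-on-xcoef R i | relation-on-ycoef R i
  ... | true  | true  | _     | _  | _  = refl
  ... | false | false | _     | _  | _  = refl
  ... | true  | false | false | rx | _  = ⊥-elim (lone-first-term (a₂ R) (a₃ R) a₁≢0 (coef-≢0 vψ≢i) rx)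
  ... | true  | false | true  | _  | ry = ⊥-elim (lone-second-term (a₁ R) (a₃ R) a₂≢0 (coef-≢0 vφ≢i) ry)
  ... | false | true  | false | rx | _  = ⊥-elim (lone-second-term (a₁ R) (a₃ R) a₂≢0 (coef-≢0 vφ≢i) rx)
  ... | false | true  | true  | _  | ry = ⊥-elim (lone-first-term (a₂ R) (a₃ R) a₁≢0 (coef-≢0 vψ≢i) ry)

p∪⁅x⁆≡q∪⁅x⁆ : {p q : Subset k} {x : Fin k} →
              q ⊆ p ∪ ⁅ x ⁆ → (∀ {i} → i ∈ p → x ≢ i → i ∈ q) → p ∪ ⁅ x ⁆ ≡ q ∪ ⁅ x ⁆
p∪⁅x⁆≡q∪⁅x⁆ {p = p} {q} {x} q⊆p∪x p-x⊆q = ⊆-antisym p∪x⊆q∪x q∪x⊆p∪x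
  where
  p∪x⊆q∪x : p ∪ ⁅ x ⁆ ⊆ q ∪ ⁅ x ⁆
  p∪x⊆q∪x {i} i∈p∪x with x∈p∪q⁻ p ⁅ x ⁆ i∈p∪x | x Fin.≟ i
  ... | inj₂ i∈x | _        = q⊆p∪q q ⁅ x ⁆ i∈x
  ... | inj₁ _   | yes refl = q⊆p∪q q ⁅ x ⁆ (x∈⁅x⁆ x)
  ... | inj₁ i∈p | no x≢i   = x∈p∪q⁺ (inj₁ (p-x⊆q i∈p x≢i))
  q∪x⊆p∪x : q ∪ ⁅ x ⁆ ⊆ p ∪ ⁅ x ⁆
  q∪x⊆p∪x i∈q∪x with x∈p∪q⁻ q ⁅ x ⁆ i∈q∪x
  ... | inj₁ i∈q = q⊆p∪x i∈q
  ... | inj₂ i∈x = q⊆p∪q p ⁅ x ⁆ i∈x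

AgreeOffCentres⇒∈Iset : AgreeOffCentres ψ φ → {i : Fin _} → i ∈ I ψ → v ψ ≢ i → i ∈ Iset φ
AgreeOffCentres⇒∈Iset {φ = φ} ψ~φ {i} i∈Iψ vψ≢i with v φ Fin.≟ i
... | yes refl = x∈p∪q⁺ (inj₂ (x∈⁅x⁆ (v φ)))
... | no vφ≢i  = x∈p∪q⁺ (inj₁ (lookup⇒[]= i (I φ) (trans (sym (agrees ψ~φ vψ≢i vφ≢i)) ([]=⇒lookup i∈Iψ))))

agreeOffCentres⇒shareCommonVars : AgreeOffCentres ψ₁ ψ₂ → AgreeOffCentres ψ₂ ψ₃ → AgreeOffCentres ψ₃ ψ₁ →
                                  ShareCommonVars3 ψ₁ ψ₂ ψ₃
agreeOffCentres⇒shareCommonVars {ψ₁ = ψ₁} {ψ₂} {ψ₃} ψ₁~ψ₂ ψ₂~ψ₃ ψ₃~ψ₁ =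
  J
  , p∪⁅x⁆≡q∪⁅x⁆ (p∩q⊆p _ _)
                (∈J AgreeOffCentres-refl ψ₁~ψ₂ (AgreeOffCentres-sym ψ₃~ψ₁))
  , p∪⁅x⁆≡q∪⁅x⁆ (p∩q⊆p _ _ ∘ p∩q⊆q _ _)
                (∈J (AgreeOffCentres-sym ψ₁~ψ₂) AgreeOffCentres-refl ψ₂~ψ₃)
  , p∪⁅x⁆≡q∪⁅x⁆ (p∩q⊆q _ _ ∘ p∩q⊆q _ _)
                (∈J ψ₃~ψ₁ (AgreeOffCentres-sym ψ₂~ψ₃) AgreeOffCentres-refl)
  where
  J : Subset _
  J = Iset ψ₁ ∩ (Iset ψ₂ ∩ Iset ψ₃)
  ∈J : AgreeOffCentres ψ ψ₁ → AgreeOffCentres ψ ψ₂ → AgreeOffCentres ψ ψ₃ →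
       ∀ {i} → i ∈ I ψ → v ψ ≢ i → i ∈ J
  ∈J ψ~ψ₁ ψ~ψ₂ ψ~ψ₃ i∈Iψ vψ≢i = x∈p∩q⁺
    ( AgreeOffCentres⇒∈Iset ψ~ψ₁ i∈Iψ vψ≢i
    , x∈p∩q⁺ (AgreeOffCentres⇒∈Iset ψ~ψ₂ i∈Iψ vψ≢i , AgreeOffCentres⇒∈Iset ψ~ψ₃ i∈Iψ vψ≢i))

lemma6p3 : (k : ℕ) → 2 ≤ k → (ψ₁ ψ₂ ψ₃ : Form k) →
    DistinctForms ψ₁ ψ₂ → DistinctForms ψ₁ ψ₃ → DistinctForms ψ₂ ψ₃ →
    Codim1 (InΠ3 ψ₁ ψ₂ ψ₃) →
    ShareCommonVars3 ψ₁ ψ₂ ψ₃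
lemma6p3 k _ ψ₁ ψ₂ ψ₃ ψ₁≢ψ₂ ψ₁≢ψ₃ ψ₂≢ψ₃ codim1 =
  agreeOffCentres⇒shareCommonVars
    (linearRelation⇒agreeOffCentres R a₁≢0 a₂≢0)
    (linearRelation⇒agreeOffCentres (rotate R) a₂≢0 a₃≢0)
    (linearRelation⇒agreeOffCentres (rotate (rotate R)) a₃≢0 a₁≢0)
  where
  R : LinearRelation ψ₁ ψ₂ ψ₃
  R = codim1⇒linearRelation codim1
  a₁≢0 : a₁ R ≢ 0ℚ
  a₁≢0 = last-coefficient-≢0 (rotate R) ψ₂≢ψ₃
  a₂≢0 : a₂ R ≢ 0ℚ
  a₂≢0 = last-coefficient-≢0 (rotate (rotate R)) (DistinctForms-sym {ψ = ψ₁} {φ = ψ₃} ψ₁≢ψ₃)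
  a₃≢0 : a₃ R ≢ 0ℚ
  a₃≢0 = last-coefficient-≢0 R ψ₁≢ψ₂
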